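{- Let $(x(n))_{n\ge0}$ and $(y(n))_{n\ge0}$ be increasing sequences of nonnegative integers such that $\{x(n):n\ge0\}\cup\{y(n):n\ge0\}=\mathbb{N}$, with $x(0)=1$, $y(0)=0$, and such that for all $n\ge0$, $$x(x(n))=y(x(n))-1\quad\text{and}\quad y(y(n))=x(y(n))-1.$$ Then $x=a$ and $y=b$, where $(a(n))_{n\ge0}$ and $(b(n))_{n\ge0}$ are the increasing enumerations (indexed from $0$) of the odious numbers (nonnegative integers with odd binary digit sum) and of the evil numbers (nonnegative integers with even binary digit sum), respectively.
   Context: $\mathbb{N}=\{0,1,2,\ldots\}$; "increasing" means strictly increasing. -}

module Defs where

open import Data.Nat using (ℕ; zero; suc; _+_; _<_; _∸_)
open import Data.Nat.DivMod using (_/_; _%_)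
open import Data.Product using (∃-syntax; _×_)
open import Data.Sum using (_⊎_)
open import Relation.Binary.PropositionalEquality using (_≡_)

-- binary digit sum, with fuel (fuel m ≥ m suffices; we use fuel = m itself)
digitSumAux : ℕ → ℕ → ℕ
digitSumAux zero    m = 0
digitSumAux (suc k) m = m % 2 + digitSumAux k (m / 2)

digitSum₂ : ℕ → ℕ
digitSum₂ m = digitSumAux m m

Odious : ℕ → Set
Odious m = digitSum₂ m % 2 ≡ 1

Evil : ℕ → Set
Evil m = digitSum₂ m % 2 ≡ 0

StrictlyIncreasing : (ℕ → ℕ) → Set
StrictlyIncreasing f = ∀ m n → m < n → f m < f n

IsIncreasingEnumeration : (ℕ → Set) → (ℕ → ℕ) → Set
IsIncreasingEnumeration P f =
  StrictlyIncreasing f × (∀ m → (∃[ n ] f n ≡ m) → P m) × (∀ m → P m → ∃[ n ] f n ≡ m)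

{-# OPTIONS --safe #-}
module Submission where

-- The functional equations say that y m = x m + 1 whenever m is a value of x, and
-- x m = y m + 1 whenever m is a value of y. As x and y are increasing and partition ℕ,
-- induction on m gives {x m, y m} = {2m, 2m + 1}, with x m = 2m exactly when m is a
-- value of x. So m is a value of x iff 2m is, iff 2m + 1 is a value of y; since
-- s₂(2m) = s₂(m) and s₂(2m + 1) = s₂(m) + 1, the odious and evil numbers obey the same
-- recursion, and strong induction identifies them with the values of x and of y.

open import Defs
open import Data.Nat using (ℕ; zero; suc; _+_; _*_; _∸_; _≤_; _<_; z≤n; s≤s; _<?_)
open import Data.Nat.Properties
open import Data.Nat.DivMod
open import Data.Nat.Induction using (<-rec)
open import Data.Product using (∃-syntax; _×_; _,_; proj₁; proj₂)
open import Data.Sum using (_⊎_; inj₁; inj₂; swap)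
import Data.Sum as Sum
open import Relation.Nullary using (¬_; yes; no; contradiction)
open import Relation.Binary.PropositionalEquality
  using (_≡_; _≢_; refl; sym; trans; cong; cong₂; subst; module ≡-Reasoning)

n≢2+n : ∀ n → n ≢ suc (suc n)
n≢2+n n eq = <-irrefl eq (m<n⇒m<1+n (n<1+n n))

m≡n∸1⇒n≡1+m : ∀ {m n} → 0 < n → m ≡ n ∸ 1 → n ≡ suc m
m≡n∸1⇒n≡1+m {n = suc n} _ refl = refl

halving : ∀ m → m ≡ 2 * (m / 2) ⊎ m ≡ 1 + 2 * (m / 2)
halving m with m % 2 | m%n<n m 2 | m≡m%n+[m/n]*n m 2
... | 0 | _ | eq = inj₁ (trans eq (*-comm (m / 2) 2))
... | 1 | _ | eq = inj₂ (trans eq (cong suc (*-comm (m / 2) 2)))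
... | suc (suc _) | s≤s (s≤s ()) | _

[1+n]/2<1+n : ∀ n → suc n / 2 < suc n
[1+n]/2<1+n n = m/n<m (suc n) 2 (n<1+n 1)

digitSumAux-zero : ∀ f → digitSumAux f 0 ≡ 0
digitSumAux-zero zero    = refl
digitSumAux-zero (suc f) = digitSumAux-zero f

digitSumAux-fuel : ∀ f g m → m ≤ f → m ≤ g → digitSumAux f m ≡ digitSumAux g m
digitSumAux-fuel zero    g       zero z≤n _   = sym (digitSumAux-zero g)
digitSumAux-fuel (suc f) zero    zero z≤n z≤n = digitSumAux-zero (suc f)
digitSumAux-fuel (suc f) (suc g) m m≤1+f m≤1+g =
  cong (m % 2 +_) (digitSumAux-fuel f g (m / 2) (half≤ m≤1+f) (half≤ m≤1+g))
  where
  half≤ : ∀ {m n} → m ≤ suc n → m / 2 ≤ n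
  half≤ {m} {n} m≤1+n = m<1+n⇒m≤n (≤-<-trans (/-monoˡ-≤ 2 m≤1+n) ([1+n]/2<1+n n))

digitSum₂-unfold : ∀ m → digitSum₂ m ≡ m % 2 + digitSum₂ (m / 2)
digitSum₂-unfold zero    = refl
digitSum₂-unfold (suc n) =
  cong (suc n % 2 +_)
       (digitSumAux-fuel n (suc n / 2) (suc n / 2) (m<1+n⇒m≤n ([1+n]/2<1+n n)) ≤-refl)

[2*k]%2≡0 : ∀ k → 2 * k % 2 ≡ 0
[2*k]%2≡0 k = trans (cong (_% 2) (*-comm 2 k)) (m*n%n≡0 k 2)

[2*k]/2≡k : ∀ k → 2 * k / 2 ≡ k
[2*k]/2≡k k = trans (cong (_/ 2) (*-comm 2 k)) (m*n/n≡m k 2)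

[1+2*k]%2≡1 : ∀ k → (1 + 2 * k) % 2 ≡ 1
[1+2*k]%2≡1 k = trans (cong (_% 2) (cong suc (*-comm 2 k))) ([m+kn]%n≡m%n 1 k 2)

[1+2*k]/2≡k : ∀ k → (1 + 2 * k) / 2 ≡ k
[1+2*k]/2≡k k = begin
  (1 + 2 * k) / 2  ≡⟨ cong (_/ 2) (cong suc (*-comm 2 k)) ⟩
  (1 + k * 2) / 2  ≡⟨ +-distrib-/ 1 (k * 2) remainders<2 ⟩
  k * 2 / 2        ≡⟨ m*n/n≡m k 2 ⟩
  k                ∎
  where
  open ≡-Reasoning
  remainders<2 : 1 % 2 + k * 2 % 2 < 2
  remainders<2 = subst (λ r → 1 + r < 2) (sym (m*n%n≡0 k 2)) ≤-refl

digitSum₂-double : ∀ k → digitSum₂ (2 * k) ≡ digitSum₂ k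
digitSum₂-double k = begin
  digitSum₂ (2 * k)                  ≡⟨ digitSum₂-unfold (2 * k) ⟩
  2 * k % 2 + digitSum₂ (2 * k / 2)  ≡⟨
    cong₂ _+_ ([2*k]%2≡0 k) (cong digitSum₂ ([2*k]/2≡k k)) ⟩
  digitSum₂ k                        ∎
  where open ≡-Reasoning

digitSum₂-double+1 : ∀ k → digitSum₂ (1 + 2 * k) ≡ 1 + digitSum₂ k
digitSum₂-double+1 k = begin
  digitSum₂ (1 + 2 * k)                          ≡⟨ digitSum₂-unfold (1 + 2 * k) ⟩
  (1 + 2 * k) % 2 + digitSum₂ ((1 + 2 * k) / 2)  ≡⟨
    cong₂ _+_ ([1+2*k]%2≡1 k) (cong digitSum₂ ([1+2*k]/2≡k k)) ⟩
  1 + digitSum₂ k                                ∎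
  where open ≡-Reasoning

[1+n]%2≡1∸n%2 : ∀ n → suc n % 2 ≡ 1 ∸ n % 2
[1+n]%2≡1∸n%2 n with n % 2 | m%n<n n 2 | %-distribˡ-+ 1 n 2
... | 0 | _ | eq = eq
... | 1 | _ | eq = eq
... | suc (suc _) | s≤s (s≤s ()) | _

Odious-double : ∀ k → Odious k → Odious (2 * k)
Odious-double k = subst (λ s → s % 2 ≡ 1) (sym (digitSum₂-double k))

Evil-double : ∀ k → Evil k → Evil (2 * k)
Evil-double k = subst (λ s → s % 2 ≡ 0) (sym (digitSum₂-double k))

Odious-double+1 : ∀ k → Evil k → Odious (1 + 2 * k)
Odious-double+1 k e = begin
  digitSum₂ (1 + 2 * k) % 2  ≡⟨ cong (_% 2) (digitSum₂-double+1 k) ⟩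
  suc (digitSum₂ k) % 2      ≡⟨ [1+n]%2≡1∸n%2 (digitSum₂ k) ⟩
  1 ∸ digitSum₂ k % 2        ≡⟨ cong (1 ∸_) e ⟩
  1                          ∎
  where open ≡-Reasoning

Evil-double+1 : ∀ k → Odious k → Evil (1 + 2 * k)
Evil-double+1 k o = begin
  digitSum₂ (1 + 2 * k) % 2  ≡⟨ cong (_% 2) (digitSum₂-double+1 k) ⟩
  suc (digitSum₂ k) % 2      ≡⟨ [1+n]%2≡1∸n%2 (digitSum₂ k) ⟩
  1 ∸ digitSum₂ k % 2        ≡⟨ cong (1 ∸_) o ⟩
  0                          ∎
  where open ≡-Reasoning

Odious⇒¬Evil : ∀ m → Odious m → ¬ Evil m
Odious⇒¬Evil _ o e = 0≢1+n (trans (sym e) o)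

Range : (ℕ → ℕ) → ℕ → Set
Range f m = ∃[ n ] f n ≡ m

strictlyIncreasing-mono-≤ : ∀ {f} → StrictlyIncreasing f → ∀ {m n} → m ≤ n → f m ≤ f n
strictlyIncreasing-mono-≤ inc {m} {n} m≤n with m≤n⇒m<n∨m≡n m≤n
... | inj₁ m<n  = <⇒≤ (inc m n m<n)
... | inj₂ refl = ≤-refl

strictlyIncreasing-cancel-< : ∀ {f} → StrictlyIncreasing f → ∀ {m n} → f m < f n → m < n
strictlyIncreasing-cancel-< inc {m} {n} fm<fn with m <? n
... | yes m<n = m<n
... | no  m≮n = contradiction (strictlyIncreasing-mono-≤ inc (≮⇒≥ m≮n)) (<⇒≱ fm<fn)

next-value-≤ : ∀ {f} → StrictlyIncreasing f → ∀ {m v} → f m < v → Range f v → f (suc m) ≤ v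
next-value-≤ inc fm<v (i , refl) =
  strictlyIncreasing-mono-≤ inc (strictlyIncreasing-cancel-< inc fm<v)

Consecutive : ℕ → ℕ → ℕ → Set
Consecutive K a b = (a ≡ K × b ≡ suc K) ⊎ (a ≡ suc K × b ≡ K)

Consecutive-sym : ∀ {K a b} → Consecutive K a b → Consecutive K b a
Consecutive-sym (inj₁ (a≡K , b≡1+K)) = inj₂ (b≡1+K , a≡K)
Consecutive-sym (inj₂ (a≡1+K , b≡K)) = inj₁ (b≡K , a≡1+K)

Consecutive-≤ : ∀ {K a b} → Consecutive K a b → a ≤ suc K × b ≤ suc K
Consecutive-≤ (inj₁ (refl , refl)) = n≤1+n _ , ≤-refl
Consecutive-≤ (inj₂ (refl , refl)) = ≤-refl , n≤1+n _

Consecutive-ordered : ∀ {K a b} → Consecutive K a b → b ≡ suc a → a ≡ K × b ≡ suc K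
Consecutive-ordered (inj₁ ab)            _  = ab
Consecutive-ordered (inj₂ (refl , refl)) eq = contradiction eq (n≢2+n _)

Consecutive-above : ∀ {K a b c} → Consecutive K a b → a < c → c ≢ b → 2 + K ≤ c
Consecutive-above (inj₁ (refl , refl)) a<c c≢b = ≤∧≢⇒< a<c (λ b≡c → c≢b (sym b≡c))
Consecutive-above (inj₂ (refl , refl)) a<c _   = a<c

squeeze-Consecutive : ∀ {K a b} → K ≤ a → K ≤ b →
                      b ≡ suc a ⊎ a ≡ suc b → a ≤ K ⊎ b ≤ K → Consecutive K a b
squeeze-Consecutive K≤a _   (inj₁ refl) (inj₁ a≤K) with ≤-antisym a≤K K≤a
... | refl = inj₁ (refl , refl)
squeeze-Consecutive K≤a _   (inj₁ refl) (inj₂ b≤K) = contradiction (≤-trans b≤K K≤a) 1+n≰n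
squeeze-Consecutive _   K≤b (inj₂ refl) (inj₁ a≤K) = contradiction (≤-trans a≤K K≤b) 1+n≰n
squeeze-Consecutive _   K≤b (inj₂ refl) (inj₂ b≤K) with ≤-antisym b≤K K≤b
... | refl = inj₂ (refl , refl)

exclusive-cases⇒⇔ : ∀ {A B P Q : ℕ → Set} → (∀ m → (A m × P m) ⊎ (B m × Q m)) →
                    (∀ m → A m → ¬ B m) → (∀ m → P m → ¬ Q m) →
                    (∀ m → A m → P m) × (∀ m → P m → A m)
exclusive-cases⇒⇔ {A = A} {P = P} cases A⇒¬B P⇒¬Q = A⇒P , P⇒A
  where
  A⇒P : ∀ m → A m → P m
  A⇒P m a with cases m
  ... | inj₁ (_ , p) = p
  ... | inj₂ (b , _) = contradiction b (A⇒¬B m a)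
  P⇒A : ∀ m → P m → A m
  P⇒A m p with cases m
  ... | inj₁ (a , _) = a
  ... | inj₂ (_ , q) = contradiction q (P⇒¬Q m p)

module Characterisation
  (x y : ℕ → ℕ) (x-inc : StrictlyIncreasing x) (y-inc : StrictlyIncreasing y)
  (covers : ∀ m → Range x m ⊎ Range y m) (x0≡1 : x 0 ≡ 1) (y0≡0 : y 0 ≡ 0)
  (xx≡yx∸1 : ∀ n → x (x n) ≡ y (x n) ∸ 1) (yy≡xy∸1 : ∀ n → y (y n) ≡ x (y n) ∸ 1)
  where

  x-positive : ∀ m → 0 < x m
  x-positive m = subst (_≤ x m) x0≡1 (strictlyIncreasing-mono-≤ x-inc z≤n)

  y-on-range-x : ∀ {m} → Range x m → y m ≡ suc (x m)
  y-on-range-x (n , refl) =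
    m≡n∸1⇒n≡1+m (≤-<-trans z≤n (y-inc 0 (x n) (x-positive n))) (xx≡yx∸1 n)

  x-on-range-y : ∀ {m} → Range y m → x m ≡ suc (y m)
  x-on-range-y (n , refl) = m≡n∸1⇒n≡1+m (x-positive (y n)) (yy≡xy∸1 n)

  ranges-disjoint : ∀ {m} → Range x m → ¬ Range y m
  ranges-disjoint {m} rx ry =
    n≢2+n (y m) (trans (y-on-range-x rx) (cong suc (x-on-range-y ry)))

  values-at : ∀ m → Consecutive (2 * m) (x m) (y m)
  values-at zero    = inj₂ (x0≡1 , y0≡0)
  values-at (suc m) =
    subst (λ K → Consecutive K (x (suc m)) (y (suc m))) (sym (*-suc 2 m))
      (squeeze-Consecutive x-above y-above adjacent one-below)
    where
    ih : Consecutive (2 * m) (x m) (y m)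
    ih = values-at m
    x-above : 2 + 2 * m ≤ x (suc m)
    x-above = Consecutive-above ih (x-inc m (suc m) (n<1+n m))
                (λ x[1+m]≡ym → ranges-disjoint (suc m , refl) (m , sym x[1+m]≡ym))
    y-above : 2 + 2 * m ≤ y (suc m)
    y-above = Consecutive-above (Consecutive-sym ih) (y-inc m (suc m) (n<1+n m))
                (λ y[1+m]≡xm → ranges-disjoint (m , sym y[1+m]≡xm) (suc m , refl))
    adjacent : y (suc m) ≡ suc (x (suc m)) ⊎ x (suc m) ≡ suc (y (suc m))
    adjacent = Sum.map y-on-range-x x-on-range-y (covers (suc m))
    one-below : x (suc m) ≤ 2 + 2 * m ⊎ y (suc m) ≤ 2 + 2 * m
    one-below = Sum.map (next-value-≤ x-inc (s≤s (proj₁ (Consecutive-≤ ih))))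
                        (next-value-≤ y-inc (s≤s (proj₂ (Consecutive-≤ ih))))
                        (covers (2 + 2 * m))

  range-x-values : ∀ {k} → Range x k → x k ≡ 2 * k × y k ≡ 1 + 2 * k
  range-x-values rx = Consecutive-ordered (values-at _) (y-on-range-x rx)

  range-y-values : ∀ {k} → Range y k → y k ≡ 2 * k × x k ≡ 1 + 2 * k
  range-y-values ry = Consecutive-ordered (Consecutive-sym (values-at _)) (x-on-range-y ry)

  Classified : ℕ → Set
  Classified m = (Range x m × Odious m) ⊎ (Range y m × Evil m)

  classify-children : ∀ {k} → Classified k → Classified (2 * k) × Classified (1 + 2 * k)
  classify-children {k} (inj₁ (rx , o)) =
    inj₁ ((k , proj₁ (range-x-values rx)) , Odious-double k o) ,
    inj₂ ((k , proj₂ (range-x-values rx)) , Evil-double+1 k o)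
  classify-children {k} (inj₂ (ry , e)) =
    inj₂ ((k , proj₁ (range-y-values ry)) , Evil-double k e) ,
    inj₁ ((k , proj₂ (range-y-values ry)) , Odious-double+1 k e)

  classified : ∀ m → Classified m
  classified = <-rec Classified step
    where
    step : ∀ m → (∀ {k} → k < m → Classified k) → Classified m
    step zero    _   = inj₂ ((0 , y0≡0) , refl)
    step (suc n) rec with halving (suc n) | classify-children (rec ([1+n]/2<1+n n))
    ... | inj₁ even | (c-even , _) = subst Classified (sym even) c-even
    ... | inj₂ odd  | (_ , c-odd)  = subst Classified (sym odd) c-odd

  x-enumerates-odious : (∀ m → Range x m → Odious m) × (∀ m → Odious m → Range x m)
  x-enumerates-odious = exclusive-cases⇒⇔ classified (λ _ → ranges-disjoint) Odious⇒¬Evil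

  y-enumerates-evil : (∀ m → Range y m → Evil m) × (∀ m → Evil m → Range y m)
  y-enumerates-evil = exclusive-cases⇒⇔ (λ m → swap (classified m))
    (λ _ ry rx → ranges-disjoint rx ry) (λ m e o → Odious⇒¬Evil m o e)

theorem5p3 : (x y : ℕ → ℕ) →
    StrictlyIncreasing x →
    StrictlyIncreasing y →
    (∀ m → (∃[ n ] x n ≡ m) ⊎ (∃[ n ] y n ≡ m)) →
    x 0 ≡ 1 →
    y 0 ≡ 0 →
    (∀ n → x (x n) ≡ y (x n) ∸ 1) →
    (∀ n → y (y n) ≡ x (y n) ∸ 1) →
    IsIncreasingEnumeration Odious x × IsIncreasingEnumeration Evil y
theorem5p3 x y x-inc y-inc covers x0≡1 y0≡0 xx≡yx∸1 yy≡xy∸1 =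
  (x-inc , x-enumerates-odious) , (y-inc , y-enumerates-evil)
  where open Characterisation x y x-inc y-inc covers x0≡1 y0≡0 xx≡yx∸1 yy≡xy∸1
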